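{- Let $f_1,f_2:\mathbb{Z}^n\to\mathbb{Z}^m$ be two $\mathbb{Z}$-homomorphisms with $\operatorname{rank}(\operatorname{im}f_1)=\operatorname{rank}(\operatorname{im}f_2)$ and $\operatorname{im}f_2\subseteq\operatorname{im}f_1$. Then the largest elementary divisor of $f_1$ divides the largest elementary divisor of $f_2$.
   Context: The elementary divisors of a $\mathbb{Z}$-homomorphism are those of an integer matrix representing it: for an integer matrix $G$ of rank $\ell$ they are the positive integers $e_1|e_2|\cdots|e_\ell$ with $SGT=\begin{pmatrix}\mathrm{diag}(e_1,\dots,e_\ell)&O\\O&O\end{pmatrix}$ for unimodular integer matrices $S,T$; the largest elementary divisor is $e_\ell$. -}

module Defs where

open import Data.Nat using (ℕ; zero; suc) renaming (_≤_ to _≤ℕ_)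
open import Data.Fin using (Fin; zero; suc)
open import Data.Integer using (ℤ; _+_; _*_; _<_; 0ℤ; 1ℤ)
open import Data.Product using (Σ; ∃; _×_)
open import Relation.Binary.PropositionalEquality using (_≡_)
open import Relation.Nullary using (¬_)

Vec' : ℕ → Set
Vec' m = Fin m → ℤ

Mat : ℕ → ℕ → Set
Mat m n = Fin m → Fin n → ℤ

∑ : (n : ℕ) → (Fin n → ℤ) → ℤ
∑ zero    f = 0ℤ
∑ (suc n) f = f zero + ∑ n (λ i → f (suc i))

_≋_ : {m : ℕ} → Vec' m → Vec' m → Set
u ≋ v = ∀ i → u i ≡ v i

_≋M_ : {m n : ℕ} → Mat m n → Mat m n → Set
A ≋M B = ∀ i j → A i j ≡ B i j

_⊗_ : {m n p : ℕ} → Mat m n → Mat n p → Mat m p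
_⊗_ {n = n} A B i k = ∑ n (λ j → A i j * B j k)

_·_ : {m n : ℕ} → Mat m n → Vec' n → Vec' m
_·_ {n = n} A x i = ∑ n (λ j → A i j * x j)

idM : (n : ℕ) → Mat n n
idM (suc n) zero    zero    = 1ℤ
idM (suc n) (suc i) (suc j) = idM n i j
idM (suc n) zero    (suc j) = 0ℤ
idM (suc n) (suc i) zero    = 0ℤ

Unimodular : {n : ℕ} → Mat n n → Set
Unimodular {n} S = Σ (Mat n n) λ S' → ((S ⊗ S') ≋M idM n) × ((S' ⊗ S) ≋M idM n)

-- The m×n matrix  ( diag(e_1,…,e_ℓ)  O ; O  O ).
diagBlock : (ℓ m n : ℕ) → (Fin ℓ → ℤ) → Mat m n
diagBlock (suc ℓ) (suc m) (suc n) e zero    zero    = e zero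
diagBlock (suc ℓ) (suc m) (suc n) e (suc i) (suc j) = diagBlock ℓ m n (λ k → e (suc k)) i j
diagBlock _ _ _ _ _ _ = 0ℤ

open import Data.Integer.Divisibility using (_∣_)
open import Data.Fin using (inject₁)

open import Data.Unit using (⊤)

DivChain : (ℓ : ℕ) → (Fin ℓ → ℤ) → Set
DivChain zero    e = ⊤
DivChain (suc k) e = ∀ (i : Fin k) → e (inject₁ i) ∣ e (suc i)

ElementaryDivisors : {m n : ℕ} → Mat m n → (ℓ : ℕ) → (Fin ℓ → ℤ) → Set
ElementaryDivisors {m} {n} G ℓ e =
  (ℓ ≤ℕ m) × (ℓ ≤ℕ n)
  × (∀ i → 0ℤ < e i)
  × DivChain ℓ e
  × Σ (Mat m m) λ S → Σ (Mat n n) λ T →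
      Unimodular S × Unimodular T × (((S ⊗ G) ⊗ T) ≋M diagBlock ℓ m n e)

InIm : {m n : ℕ} → Mat m n → Vec' m → Set
InIm {m} {n} G v = Σ (Vec' n) λ x → (G · x) ≋ v

LinIndep : {m k : ℕ} → (Fin k → Vec' m) → Set
LinIndep {m} {k} v =
  (c : Fin k → ℤ) → (∀ i → ∑ k (λ j → c j * v j i) ≡ 0ℤ) → ∀ j → c j ≡ 0ℤ

RankIm : {m n : ℕ} → Mat m n → ℕ → Set
RankIm {m} G r =
  (Σ (Fin r → Vec' m) λ v → (∀ j → InIm G (v j)) × LinIndep v)
  × ((w : Fin (suc r) → Vec' m) → (∀ j → InIm G (w j)) → ¬ LinIndep w)

module Submission where

-- Bring both maps to Smith normal form S_i G_i T_i = D_i. For the largest elementary divisor d of G₁,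
-- the vector w = S₁⁻¹ ε_top satisfies d·w ∈ im G₁. As im G₂ ⊆ im G₁ have the same rank r, a linear
-- form vanishing on r independent vectors of im G₂ vanishes on all of im G₁; so the rows of S₂
-- beyond ℓ₂ kill d·w, hence w, and therefore e·w ∈ im G₂ ⊆ im G₁ for the largest elementary
-- divisor e of G₂. The top coordinate of S₁(e·w) = e·ε_top then lies in d·ℤ, i.e. d ∣ e.

open import Defs
open import Data.Nat as ℕ using (ℕ; zero; suc; z≤n; s≤s)
import Data.Nat.Divisibility as ℕ
open import Data.Nat.Properties using (≤⇒≯)
open import Data.Fin as Fin using (Fin; zero; suc; toℕ; fromℕ; inject≤)
open import Data.Fin.Properties using (toℕ-inject≤; toℕ<n)
open import Data.Integer using (∣_∣; ℤ; _+_; _*_; 0ℤ; 1ℤ; _≟_)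
open import Data.Integer.Properties
  using (+-*-semiring; +-identityˡ; +-identityʳ; *-identityˡ; *-identityʳ; *-zeroʳ; *-assoc; *-comm;
         i*j≡0⇒i≡0∨j≡0; <⇒≢)
open import Data.Integer.Divisibility using (_∣_)
open import Data.Integer.Divisibility.Signed as Signed using (divides; ∣⇒∣ᵤ; ∣ᵤ⇒∣)
open import Data.Vec.Functional using (_∷_; tail)
open import Data.Product using (_,_)
open import Algebra.Properties.Semiring.Sum +-*-semiring
  using (sum; sum-cong-≗; sum-replicate-zero; ∑-comm; *-distribˡ-sum; *-distribʳ-sum)
open import Data.Sum using (fromInj₁; fromInj₂)
open import Relation.Binary.PropositionalEquality
open import Relation.Nullary using (¬_; yes; no; contradiction)
open import Relation.Nullary.Decidable using (decidable-stable)
open ≡-Reasoning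

∑≡sum : ∀ n (f : Fin n → ℤ) → ∑ n f ≡ sum f
∑≡sum zero    f = refl
∑≡sum (suc n) f = cong (f zero +_) (∑≡sum n (λ i → f (suc i)))

∑-cong : ∀ n {f g : Fin n → ℤ} → (∀ i → f i ≡ g i) → ∑ n f ≡ ∑ n g
∑-cong zero    f≗g = refl
∑-cong (suc n) f≗g = cong₂ _+_ (f≗g zero) (∑-cong n (λ i → f≗g (suc i)))

∑-zero : ∀ n {f : Fin n → ℤ} → (∀ i → f i ≡ 0ℤ) → ∑ n f ≡ 0ℤ
∑-zero n f≗0 = trans (∑-cong n f≗0) (trans (∑≡sum n _) (sum-replicate-zero n))

*-distribˡ-∑ : ∀ n x (f : Fin n → ℤ) → x * ∑ n f ≡ ∑ n (λ i → x * f i)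
*-distribˡ-∑ n x f = begin
  x * ∑ n f              ≡⟨ cong (x *_) (∑≡sum n f) ⟩
  x * sum f              ≡⟨ *-distribˡ-sum x f ⟩
  sum (λ i → x * f i)    ≡⟨ ∑≡sum n _ ⟨
  ∑ n (λ i → x * f i)    ∎

*-distribʳ-∑ : ∀ n x (f : Fin n → ℤ) → ∑ n f * x ≡ ∑ n (λ i → f i * x)
*-distribʳ-∑ n x f = begin
  ∑ n f * x              ≡⟨ cong (_* x) (∑≡sum n f) ⟩
  sum f * x              ≡⟨ *-distribʳ-sum x f ⟩
  sum (λ i → f i * x)    ≡⟨ ∑≡sum n _ ⟨
  ∑ n (λ i → f i * x)    ∎

∑-swap : ∀ n k (f : Fin n → Fin k → ℤ) →
         ∑ n (λ i → ∑ k (f i)) ≡ ∑ k (λ j → ∑ n (λ i → f i j))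
∑-swap n k f = begin
  ∑ n (λ i → ∑ k (f i))              ≡⟨ ∑≡sum n _ ⟩
  sum (λ i → ∑ k (f i))              ≡⟨ sum-cong-≗ (λ i → ∑≡sum k (f i)) ⟩
  sum (λ i → sum (f i))              ≡⟨ ∑-comm f ⟩
  sum (λ j → sum (λ i → f i j))      ≡⟨ sum-cong-≗ (λ j → ∑≡sum n (λ i → f i j)) ⟨
  sum (λ j → ∑ n (λ i → f i j))      ≡⟨ ∑≡sum k _ ⟨
  ∑ k (λ j → ∑ n (λ i → f i j))      ∎

dot : ∀ {n} → Vec' n → Vec' n → ℤ
dot {n} a x = ∑ n (λ j → a j * x j)

_*ᵥ_ : ∀ {n} → ℤ → Vec' n → Vec' n
(c *ᵥ x) i = c * x i

lincomb : ∀ {m k} → (Fin k → ℤ) → (Fin k → Vec' m) → Vec' m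
lincomb {k = k} c v i = ∑ k (λ j → c j * v j i)

dot-*ᵥ : ∀ {n} (a : Vec' n) c x → dot a (c *ᵥ x) ≡ c * dot a x
dot-*ᵥ {n} a c x = begin
  ∑ n (λ j → a j * (c * x j))  ≡⟨ ∑-cong n (λ j → x*[y*z]≡y*[x*z] (a j) c (x j)) ⟩
  ∑ n (λ j → c * (a j * x j))  ≡⟨ *-distribˡ-∑ n c _ ⟨
  c * dot a x                  ∎
  where
  x*[y*z]≡y*[x*z] : ∀ x y z → x * (y * z) ≡ y * (x * z)
  x*[y*z]≡y*[x*z] x y z = trans (sym (*-assoc x y z)) (trans (cong (_* z) (*-comm x y)) (*-assoc y x z))

dot-lincomb : ∀ {m k} (a : Vec' m) (c : Fin k → ℤ) (v : Fin k → Vec' m) →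
              dot a (lincomb c v) ≡ ∑ k (λ j → c j * dot a (v j))
dot-lincomb {m} {k} a c v = begin
  ∑ m (λ i → a i * ∑ k (λ j → c j * v j i))    ≡⟨ ∑-cong m (λ i → *-distribˡ-∑ k (a i) _) ⟩
  ∑ m (λ i → ∑ k (λ j → a i * (c j * v j i)))  ≡⟨ ∑-swap m k _ ⟩
  ∑ k (λ j → dot a (c j *ᵥ v j))               ≡⟨ ∑-cong k (λ j → dot-*ᵥ a (c j) (v j)) ⟩
  ∑ k (λ j → c j * dot a (v j))                ∎

·-congʳ : ∀ {m n} (A : Mat m n) {x y : Vec' n} → x ≋ y → (A · x) ≋ (A · y)
·-congʳ {n = n} A x≋y i = ∑-cong n (λ j → cong (A i j *_) (x≋y j))

·-congˡ : ∀ {m n} {A B : Mat m n} (x : Vec' n) → A ≋M B → (A · x) ≋ (B · x)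
·-congˡ {n = n} x A≋B i = ∑-cong n (λ j → cong (_* x j) (A≋B i j))

·-*ᵥ : ∀ {m n} (A : Mat m n) c x → (A · (c *ᵥ x)) ≋ (c *ᵥ (A · x))
·-*ᵥ A c x i = dot-*ᵥ (A i) c x

⊗-·-assoc : ∀ {m n p} (A : Mat m n) (B : Mat n p) (x : Vec' p) → ((A ⊗ B) · x) ≋ (A · (B · x))
⊗-·-assoc {n = n} {p} A B x i = begin
  ∑ p (λ k → ∑ n (λ j → A i j * B j k) * x k)    ≡⟨ ∑-cong p (λ k → *-distribʳ-∑ n (x k) _) ⟩
  ∑ p (λ k → ∑ n (λ j → A i j * B j k * x k))    ≡⟨ ∑-swap n p _ ⟨
  ∑ n (λ j → ∑ p (λ k → A i j * B j k * x k))    ≡⟨ ∑-cong n (λ j → ∑-cong p (λ k → *-assoc (A i j) (B j k) (x k))) ⟩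
  ∑ n (λ j → ∑ p (λ k → A i j * (B j k * x k)))  ≡⟨ ∑-cong n (λ j → *-distribˡ-∑ p (A i j) _) ⟨
  ∑ n (λ j → A i j * ∑ p (λ k → B j k * x k))    ∎

idM-· : ∀ n (x : Vec' n) → (idM n · x) ≋ x
idM-· (suc n) x zero    = begin
  1ℤ * x zero + ∑ n (λ j → 0ℤ * x (suc j))  ≡⟨ cong₂ _+_ (*-identityˡ (x zero)) (∑-zero n (λ _ → refl)) ⟩
  x zero + 0ℤ                               ≡⟨ +-identityʳ (x zero) ⟩
  x zero                                    ∎
idM-· (suc n) x (suc i) = trans (+-identityˡ _) (idM-· n (λ j → x (suc j)) i)

·-inverse : ∀ {n} (A B : Mat n n) → (A ⊗ B) ≋M idM n → ∀ x → (A · (B · x)) ≋ x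
·-inverse {n} A B AB≋I x i = begin
  (A · (B · x)) i  ≡⟨ ⊗-·-assoc A B x i ⟨
  ((A ⊗ B) · x) i  ≡⟨ ·-congˡ x AB≋I i ⟩
  (idM n · x) i    ≡⟨ idM-· n x i ⟩
  x i              ∎

·-sandwich : ∀ {m n} (S : Mat m m) (G : Mat m n) (T : Mat n n) {D : Mat m n} →
             ((S ⊗ G) ⊗ T) ≋M D → ∀ x → (S · (G · (T · x))) ≋ (D · x)
·-sandwich S G T {D} SGT≋D x i = begin
  (S · (G · (T · x))) i  ≡⟨ ⊗-·-assoc S G (T · x) i ⟨
  ((S ⊗ G) · (T · x)) i  ≡⟨ ⊗-·-assoc (S ⊗ G) T x i ⟨
  (((S ⊗ G) ⊗ T) · x) i  ≡⟨ ·-congˡ x SGT≋D i ⟩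
  (D · x) i              ∎

LinIndep-∷ : ∀ {m k} {v : Fin k → Vec' m} {z : Vec' m} (a : Vec' m) →
             LinIndep v → (∀ j → dot a (v j) ≡ 0ℤ) → dot a z ≢ 0ℤ → LinIndep (z ∷ v)
LinIndep-∷ {m} {k} {v} {z} a v-indep a⊥v a⋅z≢0 c c[z∷v]≡0 = c≡0
  where
  c₀·a⋅z≡0 : c zero * dot a z ≡ 0ℤ
  c₀·a⋅z≡0 = begin
    c zero * dot a z                           ≡⟨ +-identityʳ _ ⟨
    c zero * dot a z + 0ℤ                      ≡⟨ cong (c zero * dot a z +_) (∑-zero k (λ j →
                                                    trans (cong (c (suc j) *_) (a⊥v j)) (*-zeroʳ (c (suc j))))) ⟨
    ∑ (suc k) (λ j → c j * dot a ((z ∷ v) j))  ≡⟨ dot-lincomb a c (z ∷ v) ⟨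
    dot a (lincomb c (z ∷ v))                  ≡⟨ ∑-zero m (λ i → trans (cong (a i *_) (c[z∷v]≡0 i)) (*-zeroʳ (a i))) ⟩
    0ℤ                                         ∎
  c₀≡0 : c zero ≡ 0ℤ
  c₀≡0 = fromInj₁ (λ a⋅z≡0 → contradiction a⋅z≡0 a⋅z≢0) (i*j≡0⇒i≡0∨j≡0 (c zero) c₀·a⋅z≡0)
  c≡0 : ∀ j → c j ≡ 0ℤ
  c≡0 zero    = c₀≡0
  c≡0 (suc j) = v-indep (λ j → c (suc j)) (λ i → begin
    lincomb (λ j → c (suc j)) v i                      ≡⟨ +-identityˡ _ ⟨
    0ℤ * z i + lincomb (λ j → c (suc j)) v i           ≡⟨ cong (λ c₀ → c₀ * z i + lincomb (λ j → c (suc j)) v i) c₀≡0 ⟨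
    lincomb c (z ∷ v) i                                ≡⟨ c[z∷v]≡0 i ⟩
    0ℤ                                                 ∎) j

maximal-independent-annihilator :
  ∀ {m r} (P : Vec' m → Set) → (∀ w → (∀ j → P (w j)) → ¬ LinIndep {k = suc r} w) →
  (v : Fin r → Vec' m) → (∀ j → P (v j)) → LinIndep v →
  (a : Vec' m) → (∀ j → dot a (v j) ≡ 0ℤ) → ∀ {z} → P z → dot a z ≡ 0ℤ
maximal-independent-annihilator P no-larger v Pv v-indep a a⊥v {z} Pz =
  decidable-stable (dot a z ≟ 0ℤ) λ a⋅z≢0 →
    no-larger (z ∷ v) (λ { zero → Pz ; (suc j) → Pv j }) (LinIndep-∷ a v-indep a⊥v a⋅z≢0)

SupportedBelow : ∀ {m} → ℕ → Vec' m → Set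
SupportedBelow ℓ y = ∀ b → ℓ ℕ.≤ toℕ b → y b ≡ 0ℤ

diagBlock-·-zero : ∀ {ℓ m n} e (x : Vec' (suc n)) →
                   (diagBlock (suc ℓ) (suc m) (suc n) e · x) zero ≡ e zero * x zero
diagBlock-·-zero {n = n} e x = trans (cong (e zero * x zero +_) (∑-zero n (λ _ → refl))) (+-identityʳ _)

diagBlock-·-suc : ∀ {ℓ m n} e (x : Vec' (suc n)) b →
                  (diagBlock (suc ℓ) (suc m) (suc n) e · x) (suc b) ≡ (diagBlock ℓ m n (tail e) · tail x) b
diagBlock-·-suc e x b = +-identityˡ _

diagBlock-·-supported : ∀ ℓ {m n} e (x : Vec' n) → SupportedBelow ℓ (diagBlock ℓ m n e · x)
diagBlock-·-supported zero    {n = n}     e x b       _         = ∑-zero n (λ _ → refl)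
diagBlock-·-supported (suc ℓ) {n = zero}  e x b       _         = refl
diagBlock-·-supported (suc ℓ) {n = suc n} e x (suc b) (s≤s ℓ≤b) =
  trans (diagBlock-·-suc e x b) (diagBlock-·-supported ℓ (tail e) (tail x) b ℓ≤b)

diagBlock-·-divisible : ∀ {ℓ m n} e (x : Vec' n) (a : Fin ℓ) (ℓ≤m : ℓ ℕ.≤ m) →
                        e a ∣ (diagBlock ℓ m n e · x) (inject≤ a ℓ≤m)
diagBlock-·-divisible {n = zero} e x a _ = ℕ._∣0 ∣ e a ∣
diagBlock-·-divisible {suc ℓ} {suc m} {suc n} e x zero (s≤s _) =
  subst (e zero ∣_) (sym (diagBlock-·-zero {ℓ} {m} e x))
    (∣⇒∣ᵤ {e zero} {e zero * x zero} (Signed.∣m⇒∣m*n (x zero) Signed.∣-refl))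
diagBlock-·-divisible {n = suc n} e x (suc a) (s≤s ℓ≤m) =
  subst (e (suc a) ∣_) (sym (diagBlock-·-suc e x _)) (diagBlock-·-divisible (tail e) (tail x) a ℓ≤m)

-- Witness: x_a = (t / e_a) · y_a.
diagBlock-image-scaled : ∀ {ℓ m n} e → ℓ ℕ.≤ m → ℓ ℕ.≤ n → ∀ t → (∀ a → e a ∣ t) →
                         ∀ {y} → SupportedBelow ℓ y → InIm (diagBlock ℓ m n e) (t *ᵥ y)
diagBlock-image-scaled {zero} {n = n} e _ _ t _ y-supp =
  (λ _ → 0ℤ) , λ b → trans (∑-zero n (λ _ → refl)) (sym (trans (cong (t *_) (y-supp b z≤n)) (*-zeroʳ t)))
diagBlock-image-scaled {suc ℓ} {suc m} {suc n} e (s≤s ℓ≤m) (s≤s ℓ≤n) t e∣t {y} y-supp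
  with x , Dx≋ty ← diagBlock-image-scaled (tail e) ℓ≤m ℓ≤n t (λ a → e∣t (suc a)) (λ b h → y-supp (suc b) (s≤s h))
     | divides q t≡q*e₀ ← ∣ᵤ⇒∣ {e zero} {t} (e∣t zero)
  = q * y zero ∷ x , λ where
      zero    → begin
        (diagBlock (suc ℓ) (suc m) (suc n) e · (q * y zero ∷ x)) zero
          ≡⟨ diagBlock-·-zero {ℓ} {m} e (q * y zero ∷ x) ⟩
        e zero * (q * y zero)
          ≡⟨ *-assoc (e zero) q (y zero) ⟨
        e zero * q * y zero
          ≡⟨ cong (_* y zero) (trans (*-comm (e zero) q) (sym t≡q*e₀)) ⟩
        t * y zero
          ∎
      (suc b) → trans (diagBlock-·-suc {ℓ} {m} e (q * y zero ∷ x) b) (Dx≋ty b)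

InIm-resp-≋ : ∀ {m n} (G : Mat m n) {u v} → u ≋ v → InIm G u → InIm G v
InIm-resp-≋ G u≋v (x , Gx≋u) = x , λ i → trans (Gx≋u i) (u≋v i)

module Diagonalised {m n ℓ} (G : Mat m n) (e : Fin ℓ → ℤ) (S S⁻¹ : Mat m m) (T T⁻¹ : Mat n n)
                    (S⁻¹S≋I : (S⁻¹ ⊗ S) ≋M idM m) (TT⁻¹≋I : (T ⊗ T⁻¹) ≋M idM n)
                    (SGT≋D : ((S ⊗ G) ⊗ T) ≋M diagBlock ℓ m n e) where

  D : Mat m n
  D = diagBlock ℓ m n e

  image⇒diagonal : ∀ {v} → InIm G v → InIm D (S · v)
  image⇒diagonal {v} (x , Gx≋v) = T⁻¹ · x , λ i → begin
    (D · (T⁻¹ · x)) i              ≡⟨ ·-sandwich S G T SGT≋D (T⁻¹ · x) i ⟨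
    (S · (G · (T · (T⁻¹ · x)))) i  ≡⟨ ·-congʳ S (·-congʳ G (·-inverse T T⁻¹ TT⁻¹≋I x)) i ⟩
    (S · (G · x)) i                ≡⟨ ·-congʳ S Gx≋v i ⟩
    (S · v) i                      ∎

  diagonal⇒image : ∀ {v} → InIm D (S · v) → InIm G v
  diagonal⇒image {v} (x , Dx≋Sv) = T · x , λ i → begin
    (G · (T · x)) i                ≡⟨ ·-inverse S⁻¹ S S⁻¹S≋I _ i ⟨
    (S⁻¹ · (S · (G · (T · x)))) i  ≡⟨ ·-congʳ S⁻¹ (λ b → trans (·-sandwich S G T SGT≋D x b) (Dx≋Sv b)) i ⟩
    (S⁻¹ · (S · v)) i              ≡⟨ ·-inverse S⁻¹ S S⁻¹S≋I v i ⟩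
    v i                            ∎

  image-supported : ∀ {v} → InIm G v → SupportedBelow ℓ (S · v)
  image-supported v∈im b ℓ≤b with x , Dx≋Sv ← image⇒diagonal v∈im =
    trans (sym (Dx≋Sv b)) (diagBlock-·-supported ℓ e x b ℓ≤b)

  image-divisible : ∀ {v} → InIm G v → (a : Fin ℓ) (ℓ≤m : ℓ ℕ.≤ m) → e a ∣ (S · v) (inject≤ a ℓ≤m)
  image-divisible v∈im a ℓ≤m with x , Dx≋Sv ← image⇒diagonal v∈im =
    subst (e a ∣_) (Dx≋Sv (inject≤ a ℓ≤m)) (diagBlock-·-divisible e x a ℓ≤m)

  image-scaled : ℓ ℕ.≤ m → ℓ ℕ.≤ n → ∀ t → (∀ a → e a ∣ t) →
                 ∀ {w} → SupportedBelow ℓ (S · w) → InIm G (t *ᵥ w)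
  image-scaled ℓ≤m ℓ≤n t e∣t {w} Sw-supp = diagonal⇒image
    (InIm-resp-≋ D (λ i → sym (·-*ᵥ S t w i)) (diagBlock-image-scaled e ℓ≤m ℓ≤n t e∣t Sw-supp))

DivChain-∣-last : ∀ k (e : Fin (suc k) → ℤ) → DivChain (suc k) e → ∀ a → e a ∣ e (fromℕ k)
DivChain-∣-last zero    e _     zero    = ℕ.∣-refl
DivChain-∣-last (suc k) e chain zero    =
  ℕ.∣-trans (chain zero) (DivChain-∣-last k (tail e) (λ i → chain (suc i)) zero)
DivChain-∣-last (suc k) e chain (suc a) = DivChain-∣-last k (tail e) (λ i → chain (suc i)) a

basis : ∀ {m} → Fin m → Vec' m
basis i j with i Fin.≟ j
... | yes _ = 1ℤ
... | no  _ = 0ℤ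

basis-same : ∀ {m} (i : Fin m) → basis i i ≡ 1ℤ
basis-same i with i Fin.≟ i
... | yes _   = refl
... | no  i≢i = contradiction refl i≢i

basis-inject≤-supported : ∀ {ℓ m} (a : Fin ℓ) (ℓ≤m : ℓ ℕ.≤ m) → SupportedBelow ℓ (basis (inject≤ a ℓ≤m))
basis-inject≤-supported a ℓ≤m b ℓ≤b with inject≤ a ℓ≤m Fin.≟ b
... | no  _   = refl
... | yes refl = contradiction (subst (ℕ._< _) (sym (toℕ-inject≤ a ℓ≤m)) (toℕ<n a)) (≤⇒≯ ℓ≤b)

lemma2p3 : (n m : ℕ) (G₁ G₂ : Mat m n) (r : ℕ)
    → RankIm G₁ r → RankIm G₂ r
    → (∀ v → InIm G₂ v → InIm G₁ v)
    → (k₁ : ℕ) (e₁ : _) → ElementaryDivisors G₁ (suc k₁) e₁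
    → (k₂ : ℕ) (e₂ : _) → ElementaryDivisors G₂ (suc k₂) e₂
    → e₁ (fromℕ k₁) ∣ e₂ (fromℕ k₂)
lemma2p3 n m G₁ G₂ r (_ , no-larger-indep₁) ((v , v∈im₂ , v-indep) , _) im₂⊆im₁
  k₁ e₁ (ℓ₁≤m , ℓ₁≤n , e₁>0 , chain₁ , S₁ , T₁ , (S₁⁻¹ , S₁S₁⁻¹≋I , S₁⁻¹S₁≋I) , (T₁⁻¹ , T₁T₁⁻¹≋I , _) , SGT₁)
  k₂ e₂ (ℓ₂≤m , ℓ₂≤n , _ , chain₂ , S₂ , T₂ , (S₂⁻¹ , _ , S₂⁻¹S₂≋I) , (T₂⁻¹ , T₂T₂⁻¹≋I , _) , SGT₂)
  = subst (d ∣_) S₁[e·w]-top (D₁.image-divisible (im₂⊆im₁ _ e·w∈im₂) (fromℕ k₁) ℓ₁≤m)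
  where
  module D₁ = Diagonalised G₁ e₁ S₁ S₁⁻¹ T₁ T₁⁻¹ S₁⁻¹S₁≋I T₁T₁⁻¹≋I SGT₁
  module D₂ = Diagonalised G₂ e₂ S₂ S₂⁻¹ T₂ T₂⁻¹ S₂⁻¹S₂≋I T₂T₂⁻¹≋I SGT₂
  d = e₁ (fromℕ k₁)
  e = e₂ (fromℕ k₂)
  top = inject≤ (fromℕ k₁) ℓ₁≤m
  w = S₁⁻¹ · basis top

  d·w∈im₁ : InIm G₁ (d *ᵥ w)
  d·w∈im₁ = D₁.image-scaled ℓ₁≤m ℓ₁≤n d (DivChain-∣-last k₁ e₁ chain₁) λ b ℓ₁≤b →
    trans (·-inverse S₁ S₁⁻¹ S₁S₁⁻¹≋I _ b) (basis-inject≤-supported (fromℕ k₁) ℓ₁≤m b ℓ₁≤b)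

  S₂-supported-on-im₁ : ∀ {z} → InIm G₁ z → SupportedBelow (suc k₂) (S₂ · z)
  S₂-supported-on-im₁ z∈im₁ b ℓ₂≤b =
    maximal-independent-annihilator (InIm G₁) no-larger-indep₁ v (λ j → im₂⊆im₁ _ (v∈im₂ j)) v-indep
      (S₂ b) (λ j → D₂.image-supported (v∈im₂ j) b ℓ₂≤b) z∈im₁

  e·w∈im₂ : InIm G₂ (e *ᵥ w)
  e·w∈im₂ = D₂.image-scaled ℓ₂≤m ℓ₂≤n e (DivChain-∣-last k₂ e₂ chain₂) λ b ℓ₂≤b →
    fromInj₂ (λ d≡0 → contradiction (sym d≡0) (<⇒≢ (e₁>0 (fromℕ k₁))))
      (i*j≡0⇒i≡0∨j≡0 d (trans (sym (·-*ᵥ S₂ d w b)) (S₂-supported-on-im₁ d·w∈im₁ b ℓ₂≤b)))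

  S₁[e·w]-top : (S₁ · (e *ᵥ w)) top ≡ e
  S₁[e·w]-top = begin
    (S₁ · (e *ᵥ w)) top  ≡⟨ ·-*ᵥ S₁ e w top ⟩
    e * (S₁ · w) top     ≡⟨ cong (e *_) (trans (·-inverse S₁ S₁⁻¹ S₁S₁⁻¹≋I _ top) (basis-same top)) ⟩
    e * 1ℤ               ≡⟨ *-identityʳ e ⟩
    e                    ∎
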